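{- Let $P$ be a non-empty set and $\mathcal{L}$ a set of formulae with semantic function $[\![\cdot]\!]:\mathcal{L}\to\mathcal{P}(P)$ such that $\mathcal{L}(p)\neq\emptyset$ for every $p\in P$. Let $\phi\in\mathcal{L}$, let $p$ be a minimal element of $[\![\phi]\!]$ such that a characteristic formula $\chi(p)$ for $p$ exists in $\mathcal{L}$, and let $\bar\chi(p)\in\mathcal{L}$ be a formula such that $\{q\in P\mid \mathcal{L}(q)\not\subseteq\mathcal{L}(p)\}\subseteq[\![\bar\chi(p)]\!]$. Then $[\![\phi]\!]\setminus[\![\chi(p)]\!]\subseteq[\![\bar\chi(p)]\!]$.
   Context: For $p\in P$, $\mathcal{L}(p)=\{\phi\in\mathcal{L}\mid p\in[\![\phi]\!]\}$. For $S\subseteq P$, an element $p\in S$ is minimal in $S$ iff for each $q\in S$, $\mathcal{L}(q)\subseteq\mathcal{L}(p)$ implies $\mathcal{L}(q)=\mathcal{L}(p)$. A formula $\chi(p)$ is characteristic for $p$ iff for all $q\in P$: $q\in[\![\chi(p)]\!]$ iff $\mathcal{L}(p)\subseteq\mathcal{L}(q)$. -}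

module Defs where

open import Level using (Level; _⊔_)
open import Data.Product using (Σ; ∃; _×_)
open import Relation.Nullary using (¬_)

-- A semantics: a set P of points, a set Form of formulae, and a semantic
-- relation  sat q φ  meaning  q ∈ ⟦φ⟧  (⟦·⟧ : Form → 𝒫(P) as predicates).
module Semantics {a b c : Level} (P : Set a) (Form : Set b) (sat : P → Form → Set c) where

  ⟦_⟧ : Form → P → Set c
  ⟦ φ ⟧ q = sat q φ

  𝓛 : P → Form → Set c
  𝓛 p φ = sat p φ

  _⊑_ : P → P → Set (b ⊔ c)
  p ⊑ q = ∀ φ → 𝓛 p φ → 𝓛 q φ

  _≋_ : P → P → Set (b ⊔ c)
  p ≋ q = (p ⊑ q) × (q ⊑ p)

  Minimal : ∀ {d} → (P → Set d) → P → Set (a ⊔ b ⊔ c ⊔ d)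
  Minimal S p = S p × (∀ q → S q → q ⊑ p → q ≋ p)

  Characteristic : P → Form → Set (a ⊔ b ⊔ c)
  Characteristic p χ = ∀ q → (sat q χ → p ⊑ q) × (p ⊑ q → sat q χ)

{-# OPTIONS --safe #-}
module Submission where

open import Defs
open import Level using (Level)
open import Data.Product using (∃; _,_; proj₂)
open import Relation.Nullary using (¬_)

module _ {a b c : Level} {P : Set a} {Form : Set b} {sat : P → Form → Set c} where
  open Semantics P Form sat

  Minimal-⊑⇒⊒ : ∀ {d} {S : P → Set d} {p q : P} → Minimal S p → S q → q ⊑ p → p ⊑ q
  Minimal-⊑⇒⊒ (_ , minimal) Sq q⊑p = proj₂ (minimal _ Sq q⊑p)

  Characteristic-¬sat⇒⋢ : ∀ {p χ q} → Characteristic p χ → ¬ ⟦ χ ⟧ q → ¬ (p ⊑ q)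
  Characteristic-¬sat⇒⋢ {q = q} char ¬χq p⊑q = ¬χq (proj₂ (char q) p⊑q)

mainTheorem8 : ∀ {a b c : Level} (P : Set a) (Form : Set b) (sat : P → Form → Set c)
    → let open Semantics P Form sat in
    P
    → (∀ p → ∃ λ φ → 𝓛 p φ)
    → (φ : Form) (p : P) (χ χ̄ : Form)
    → Minimal ⟦ φ ⟧ p
    → Characteristic p χ
    → (∀ q → ¬ (q ⊑ p) → ⟦ χ̄ ⟧ q)
    → ∀ q → ⟦ φ ⟧ q → ¬ ⟦ χ ⟧ q → ⟦ χ̄ ⟧ q
mainTheorem8 _ _ _ _ _ _ _ _ _ minimal char beyond q φq ¬χq =
  beyond q λ q⊑p → Characteristic-¬sat⇒⋢ char ¬χq (Minimal-⊑⇒⊒ minimal φq q⊑p)
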